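{- The Action Rule is sound. Precisely: let $\Sigma$ be an action signature, $\alpha$ a simple action of $\mathcal L(\Sigma)$, $\psi$ a sentence, $C\subseteq$ Agents, and let $\chi_\beta$ be sentences for all simple actions $\beta$ with $\alpha\to^*_C\beta$ in $\Omega$ such that (1) $\chi_\beta\to[\beta]\psi$ is valid for each such $\beta$, and (2) whenever $A\in C$, $\alpha\to^*_C\beta$ and $\beta\to_A\gamma$ in $\Omega$, the sentence $(\chi_\beta\wedge\mathrm{Pre}(\beta))\to\Box_A\chi_\gamma$ is valid. Then $\chi_\alpha\to[\alpha]\Box^*_C\psi$ is valid.
   Context: Fix AtSen and Agents. A state model is $\mathbf S=(S,(\to_A)_{A\in\mathrm{Agents}},\|\cdot\|)$. An action signature $\Sigma$: a finite set with relations $\to_A$ and an enumeration $\sigma_1,\dots,\sigma_n$. $\mathcal L(\Sigma)$: sentences $\mathsf{true}\mid p\mid\neg\varphi\mid\varphi\wedge\psi\mid\Box_A\varphi\mid\Box^*_B\varphi\mid[\pi]\varphi$; programs $\mathsf{skip}\mid\mathsf{crash}\mid\sigma_i\psi_1\cdots\psi_n\mid\pi\cup\rho\mid\pi;\rho\mid\pi^*$. Semantics: $\Box_A$ via $\to_A$; $\Box^*_B$ via the reflexive-transitive closure of $\bigcup_{A\in B}\to_A$; each program gives for every $\mathbf S$ a model $\mathbf S(\pi)$ and relation $\pi_{\mathbf S}\subseteq S\times S(\pi)$ with $s\in[\![[\pi]\varphi]\!]_{\mathbf S}$ iff all $\pi_{\mathbf S}$-successors of $s$ satisfy $\varphi$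 in $\mathbf S(\pi)$. $\mathsf{skip}$: identity; $\mathsf{crash}$: empty; $\sigma_i\vec\psi$: states $(s,\sigma_j)$, $s\in[\![\psi_j]\!]_{\mathbf S}$, arrows $(s,\sigma_j)\to_A(t,\sigma_k)$ iff $s\to_A t$ and $\sigma_j\to_A\sigma_k$, valuation from $s$, relation $s\mapsto(s,\sigma_i)$ for $s\in[\![\psi_i]\!]_{\mathbf S}$; $;$ composes model transformations and relations; $\cup$ takes disjoint unions; $\pi^*$ is the union of all iterates $\pi^m$. Valid = true at every state of every state model. $\langle\pi\rangle=\neg[\pi]\neg$. A simple action is a program without $\cup$ and $*$. $\Omega$: the simple actions with the smallest relations $\to_A$ such that $\mathsf{skip}\to_A\mathsf{skip}$, $\sigma_i\vec\varphi\to_A\sigma_j\vec\psi$ iff $\sigma_i\to_A\sigma_j$ in $\Sigma$ and $\vec\varphi=\vec\psi$, and $\alpha;\beta\to_A\alpha';\beta'$ when $\alpha\to_A\alpha'$ and $\beta\to_A\beta'$; $\to^*_C$ is the reflexive-transitive closure of $\bigcup_{A\in C}\to_A$. $\mathrm{Pre}(\mathsf{skip})=\mathsf{true}$, $\mathrm{Pre}(\mathsf{crash})=\mathsf{false}$, $\mathrm{Pre}(\sigma_i\vec\psi)=\psi_i$, $\mathrm{Pre}(\alpha;\beta)=\langle\alpha\rangle\mathrm{Pre}(\beta)$. -}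

module Defs where

open import Data.Nat using (ℕ; zero; suc)
open import Data.Fin using (Fin; zero; suc)
open import Data.Vec using (Vec; []; _∷_; lookup)
open import Data.Bool using (Bool; true)
open import Data.Product using (Σ; _×_; _,_)
open import Data.Sum using (_⊎_; inj₁; inj₂)
open import Data.Unit using (⊤)
open import Data.Empty using (⊥)
open import Relation.Nullary using (¬_)
open import Relation.Binary.PropositionalEquality using (_≡_; subst)
open import Relation.Binary.Construct.Closure.ReflexiveTransitive using (Star)

record ActionSignature (Agents : Set) : Set₁ where
  field
    size : ℕ
    sigArr : Agents → Fin size → Fin size → Set

record StateModel (AtSen Agents : Set) : Set₁ where
  field
    State : Set
    arr   : Agents → State → State → Set
    val   : State → AtSen → Bool

module Language (AtSen Agents : Set) (Sig : ActionSignature Agents) where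
  open ActionSignature Sig

  data Sen : Set₁
  data Prog : Set₁

  data Sen where
    true'   : Sen
    atom    : AtSen → Sen
    neg     : Sen → Sen
    and     : Sen → Sen → Sen
    box     : Agents → Sen → Sen
    boxStar : (Agents → Set) → Sen → Sen
    after   : Prog → Sen → Sen

  data Prog where
    skip  : Prog
    crash : Prog
    act   : Fin size → Vec Sen size → Prog
    _∪_   : Prog → Prog → Prog
    _⨾_   : Prog → Prog → Prog
    star  : Prog → Prog

  Model : Set₁
  Model = StateModel AtSen Agents

  open StateModel

  reachB : (M : Model) → (Agents → Set) → State M → State M → Set
  reachB M B = Star (λ s t → Σ Agents λ A → B A × arr M A s t)

  emptyModel : Model
  emptyModel = record { State = ⊥ ; arr = λ _ _ _ → ⊥ ; val = λ () }

  _⊕_ : Model → Model → Model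
  M ⊕ N = record { State = State M ⊎ State N ; arr = a ; val = v }
    where
    a : Agents → State M ⊎ State N → State M ⊎ State N → Set
    a A (inj₁ x) (inj₁ y) = arr M A x y
    a A (inj₂ x) (inj₂ y) = arr N A x y
    a A _ _ = ⊥
    v : State M ⊎ State N → AtSen → Bool
    v (inj₁ x) = val M x
    v (inj₂ x) = val N x

  ⨁ : (ℕ → Model) → Model
  ⨁ F = record
    { State = Σ ℕ (λ m → State (F m))
    ; arr = λ { A (m , x) (m' , y) →
                  Σ (m ≡ m') λ e → arr (F m') A (subst (λ k → State (F k)) e x) y }
    ; val = λ { (m , x) → val (F m) x }
    }

  mutual
    ⟦_⟧ : Sen → (M : Model) → State M → Set
    ⟦ true' ⟧ M s = ⊤
    ⟦ atom p ⟧ M s = val M s p ≡ true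
    ⟦ neg φ ⟧ M s = ¬ ⟦ φ ⟧ M s
    ⟦ and φ ψ ⟧ M s = ⟦ φ ⟧ M s × ⟦ ψ ⟧ M s
    ⟦ box A φ ⟧ M s = ∀ t → arr M A s t → ⟦ φ ⟧ M t
    ⟦ boxStar B φ ⟧ M s = ∀ t → reachB M B s t → ⟦ φ ⟧ M t
    ⟦ after π φ ⟧ M s = ∀ t → rel π M s t → ⟦ φ ⟧ (upd π M) t

    preAt : ∀ {k} → Vec Sen k → (M : Model) → Fin k → State M → Set
    preAt (ψ ∷ ψs) M zero s = ⟦ ψ ⟧ M s
    preAt (ψ ∷ ψs) M (suc j) s = preAt ψs M j s

    upd : Prog → Model → Model
    upd skip M = M
    upd crash M = emptyModel
    upd (act i ψs) M = record
      { State = Σ (State M × Fin size) (λ { (s , j) → preAt ψs M j s })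
      ; arr = λ { A ((s , j) , _) ((t , k) , _) → arr M A s t × sigArr A j k }
      ; val = λ { ((s , _) , _) → val M s }
      }
    upd (π ∪ ρ) M = upd π M ⊕ upd ρ M
    upd (π ⨾ ρ) M = upd ρ (upd π M)
    upd (star π) M = ⨁ (λ m → iter π m M)

    iter : Prog → ℕ → Model → Model
    iter π zero M = M
    iter π (suc m) M = upd π (iter π m M)

    rel : (π : Prog) → (M : Model) → State M → State (upd π M) → Set
    rel skip M s t = s ≡ t
    rel crash M s ()
    rel (act i ψs) M s ((t , j) , _) = (s ≡ t) × (j ≡ i)
    rel (π ∪ ρ) M s (inj₁ t) = rel π M s t
    rel (π ∪ ρ) M s (inj₂ t) = rel ρ M s t
    rel (π ⨾ ρ) M s u = Σ (State (upd π M)) λ t → rel π M s t × rel ρ (upd π M) t u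
    rel (star π) M s (m , t) = iterRel π m M s t

    iterRel : (π : Prog) → (m : ℕ) → (M : Model) → State M → State (iter π m M) → Set
    iterRel π zero M s t = s ≡ t
    iterRel π (suc m) M s u =
      Σ (State (iter π m M)) λ t → iterRel π m M s t × rel π (iter π m M) t u

  false' : Sen
  false' = neg true'

  _⇒_ : Sen → Sen → Sen
  φ ⇒ ψ = neg (and φ (neg ψ))

  ⟨_⟩_ : Prog → Sen → Sen
  ⟨ π ⟩ φ = neg (after π (neg φ))

  Valid : Sen → Set₁
  Valid φ = (M : Model) (s : State M) → ⟦ φ ⟧ M s

  data Simple : Prog → Set₁ where
    skipS  : Simple skip
    crashS : Simple crash
    actS   : ∀ i ψs → Simple (act i ψs)
    seqS   : ∀ {α β} → Simple α → Simple β → Simple (α ⨾ β)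

  -- Pre; only meaningful on simple actions (the ∪ / star clauses are junk and
  -- never used, since only simple actions are reachable in Ω from a simple one)
  Pre : Prog → Sen
  Pre skip = true'
  Pre crash = false'
  Pre (act i ψs) = lookup ψs i
  Pre (α ⨾ β) = ⟨ α ⟩ Pre β
  Pre (π ∪ ρ) = false'
  Pre (star π) = false'

  data _⟶Ω⟨_⟩_ : Prog → Agents → Prog → Set₁ where
    skip→ : ∀ {A} → skip ⟶Ω⟨ A ⟩ skip
    act→  : ∀ {A i j ψs} → sigArr A i j → act i ψs ⟶Ω⟨ A ⟩ act j ψs
    seq→  : ∀ {A α α' β β'} → α ⟶Ω⟨ A ⟩ α' → β ⟶Ω⟨ A ⟩ β' →
            (α ⨾ β) ⟶Ω⟨ A ⟩ (α' ⨾ β')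

  _⟶Ω*⟨_⟩_ : Prog → (Agents → Set) → Prog → Set₁
  α ⟶Ω*⟨ C ⟩ β = Star (λ β γ → Σ Agents λ A → C A × β ⟶Ω⟨ A ⟩ γ) α β

{-# OPTIONS --safe #-}
module Submission where

-- Every arrow of S(β) out of a β-image (s, β) comes from an arrow s →_A s₁ of S together with an
-- Ω-arrow β →_A γ, and lands on the γ-image of s₁; moreover S(β) = S(γ), since Ω-arrows only move
-- the designated indices of the action, which S(·) ignores. So along every C-path starting at the
-- α-image of a χ_α-state, each visited state is the β-image of a χ_β-state for some β with
-- α →*_C β: hypothesis (2) propagates χ along the path (Pre β holds at the source of every
-- β-image), and hypothesis (1) then yields ψ at the end.

open import Defs
open import Data.Fin using (zero; suc)
open import Data.Vec using (Vec; _∷_; lookup)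
open import Data.Bool using (true; false)
open import Data.Product using (_,_; proj₁; proj₂)
open import Data.Unit using (tt)
open import Data.Empty using (⊥-elim)
open import Relation.Nullary using (¬_)
open import Relation.Binary.PropositionalEquality
  using (_≡_; refl; subst; trans; cong)
open import Relation.Binary.PropositionalEquality.Properties using (subst-subst; subst-∘)
open import Relation.Binary.Construct.Closure.ReflexiveTransitive using (ε; _◅_; _◅◅_)

module ActionRule {AtSen Agents : Set} (Sig : ActionSignature Agents) where
  open Language AtSen Agents Sig
  open StateModel

  -- φ ⇒ ψ is encoded as ¬ (φ ∧ ¬ ψ), so modus ponens needs ¬¬-stability of the semantics.
  ⟦⟧-stable : ∀ φ M s → ¬ ¬ ⟦ φ ⟧ M s → ⟦ φ ⟧ M s
  ⟦⟧-stable true'         M s ¬¬φ = tt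
  ⟦⟧-stable (atom p)      M s ¬¬φ with val M s p
  ... | true  = refl
  ... | false = ⊥-elim (¬¬φ λ ())
  ⟦⟧-stable (neg φ)       M s ¬¬φ = λ x → ¬¬φ (λ k → k x)
  ⟦⟧-stable (and φ ψ)     M s ¬¬φ =
    ⟦⟧-stable φ M s (λ k → ¬¬φ (λ p → k (proj₁ p))) , ⟦⟧-stable ψ M s (λ k → ¬¬φ (λ p → k (proj₂ p)))
  ⟦⟧-stable (box A φ)     M s ¬¬φ = λ t a → ⟦⟧-stable φ M t (λ k → ¬¬φ (λ f → k (f t a)))
  ⟦⟧-stable (boxStar B φ) M s ¬¬φ = λ t p → ⟦⟧-stable φ M t (λ k → ¬¬φ (λ f → k (f t p)))
  ⟦⟧-stable (after π φ)   M s ¬¬φ = λ t r → ⟦⟧-stable φ (upd π M) t (λ k → ¬¬φ (λ f → k (f t r)))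

  ⇒-elim : ∀ {φ ψ M s} → ⟦ φ ⇒ ψ ⟧ M s → ⟦ φ ⟧ M s → ⟦ ψ ⟧ M s
  ⇒-elim {ψ = ψ} {M} {s} φ⇒ψ φ = ⟦⟧-stable ψ M s (λ ¬ψ → φ⇒ψ (φ , ¬ψ))

  preAt⇒lookup : ∀ {k} (ψs : Vec Sen k) M j s → preAt ψs M j s → ⟦ lookup ψs j ⟧ M s
  preAt⇒lookup (ψ ∷ ψs) M zero    s p = p
  preAt⇒lookup (ψ ∷ ψs) M (suc j) s p = preAt⇒lookup ψs M j s p

  rel⇒Pre : ∀ {β} → Simple β → ∀ {M s u} → rel β M s u → ⟦ Pre β ⟧ M s
  rel⇒Pre skipS        r             = tt
  rel⇒Pre crashS       {u = ()}
  rel⇒Pre (actS i ψs)  {M} {s} {u = (_ , j) , p} (refl , refl) = preAt⇒lookup ψs M j s p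
  rel⇒Pre (seqS β₁ β₂) (t , r₁ , r₂) = λ ¬Pre → ¬Pre t r₁ (rel⇒Pre β₂ r₂)

  upd-⟶Ω : ∀ {β A γ} → β ⟶Ω⟨ A ⟩ γ → ∀ M → upd β M ≡ upd γ M
  upd-⟶Ω skip→ M = refl
  upd-⟶Ω (act→ _) M = refl
  upd-⟶Ω (seq→ {α = β₁} {β' = γ₂} d₁ d₂) M =
    trans (upd-⟶Ω d₂ (upd β₁ M)) (cong (upd γ₂) (upd-⟶Ω d₁ M))

  arr-subst : ∀ {N N' : Model} (e : N ≡ N') A {x y} → arr N A x y →
              arr N' A (subst State e x) (subst State e y)
  arr-subst refl A a = a

  rel-subst : ∀ γ {N N'} (e : N ≡ N') {x y} → rel γ N x y →
              rel γ N' (subst State e x) (subst (λ K → State (upd γ K)) e y)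
  rel-subst γ refl r = r

  ⟦⟧-subst⁻ : ∀ ψ {N N'} (e : N ≡ N') w → ⟦ ψ ⟧ N' (subst State e w) → ⟦ ψ ⟧ N w
  ⟦⟧-subst⁻ ψ refl w h = h

  record ArrowLift {β} (M : Model) (A : Agents) (s : State M) (u₁ : State (upd β M)) : Set₁ where
    field
      {γ}    : Prog
      simple : Simple γ
      step   : β ⟶Ω⟨ A ⟩ γ
      s₁     : State M
      arrow  : arr M A s s₁
      image  : rel γ M s₁ (subst State (upd-⟶Ω step M) u₁)

  arr-upd-lift : ∀ {β} → Simple β → ∀ M A {s u u₁} →
                 rel β M s u → arr (upd β M) A u u₁ → ArrowLift M A s u₁
  arr-upd-lift skipS M A refl a = record
    { simple = skipS ; step = skip→ ; arrow = a ; image = refl }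
  arr-upd-lift crashS M A {u = ()}
  arr-upd-lift (actS i ψs) M A {u₁ = (_ , k) , _} (refl , refl) (a , σa) = record
    { simple = actS k ψs ; step = act→ σa ; arrow = a ; image = refl , refl }
  arr-upd-lift (seqS {β₁} {β₂} sβ₁ sβ₂) M A {u₁ = u₁} (t , r₁ , r₂) a =
    record
      { simple = seqS L₁.simple L₂.simple
      ; step   = seq→ L₁.step L₂.step
      ; arrow  = L₁.arrow
      ; image  = subst State e₁ L₂.s₁ , L₁.image , subst (rel γ₂ _ _) transports r₂'
      }
    where
    module L₂ = ArrowLift {β₂} (arr-upd-lift sβ₂ (upd β₁ M) A r₂ a)
    module L₁ = ArrowLift {β₁} (arr-upd-lift sβ₁ M A r₁ L₂.arrow)
    γ₂ = L₂.γ
    e₁ = upd-⟶Ω L₁.step M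
    e₂ = upd-⟶Ω L₂.step (upd β₁ M)
    r₂' = rel-subst γ₂ e₁ L₂.image
    transports : subst (λ K → State (upd γ₂ K)) e₁ (subst State e₂ u₁)
               ≡ subst State (trans e₂ (cong (upd γ₂) e₁)) u₁
    transports = trans (subst-∘ e₁) (subst-subst e₂)

  module _ (α : Prog) (C : Agents → Set) (χ : Prog → Sen) where

    -- N is only propositionally equal to S(β): S(β) and S(γ) agree for β →_A γ but not definitionally.
    record Tracked (N : Model) (w : State N) : Set₁ where
      field
        {β}     : Prog
        path    : α ⟶Ω*⟨ C ⟩ β
        simple  : Simple β
        {M}     : Model
        {s}     : State M
        model   : N ≡ upd β M
        χ-holds : ⟦ χ β ⟧ M s
        image   : rel β M s (subst State model w)

    module _ (ψ : Sen)
      (χ⇒[β]ψ : ∀ β → α ⟶Ω*⟨ C ⟩ β → Valid (χ β ⇒ after β ψ))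
      (χ∧Pre⇒□χ : ∀ A β γ → C A → α ⟶Ω*⟨ C ⟩ β → β ⟶Ω⟨ A ⟩ γ →
                   Valid (and (χ β) (Pre β) ⇒ box A (χ γ))) where

      tracked⇒ψ : ∀ {N w} → Tracked N w → ⟦ ψ ⟧ N w
      tracked⇒ψ {w = w} tr =
        ⟦⟧-subst⁻ ψ model w (⇒-elim {ψ = after β ψ} (χ⇒[β]ψ β path M s) χ-holds _ image)
        where open Tracked tr

      tracked-arr : ∀ {N w w₁ A} → C A → arr N A w w₁ → Tracked N w → Tracked N w₁
      tracked-arr {A = A} A∈C a tr = record
        { path    = path ◅◅ ((A , A∈C , step) ◅ ε)
        ; simple  = L.simple
        ; model   = trans model (upd-⟶Ω step M)
        ; χ-holds = ⇒-elim {ψ = box A (χ γ)} (χ∧Pre⇒□χ A β γ A∈C path step M s)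
                           (χ-holds , rel⇒Pre simple image) s₁ arrow
        ; image   = subst (rel γ M s₁) (subst-subst model) L.image
        }
        where
        open Tracked tr
        module L = ArrowLift {β} (arr-upd-lift simple M A image (arr-subst model A a))
        open L using (γ; step; s₁; arrow)

      tracked-reach : ∀ {N w v} → reachB N C w v → Tracked N w → Tracked N v
      tracked-reach ε                    tr = tr
      tracked-reach ((A , A∈C , a) ◅ p) tr = tracked-reach p (tracked-arr A∈C a tr)

      action-rule : Simple α → Valid (χ α ⇒ after α (boxStar C ψ))
      action-rule sα M s (χα , ¬[α]□ψ) = ¬[α]□ψ λ t r v p →
        tracked⇒ψ (tracked-reach p (record
          { path = ε ; simple = sα ; model = refl ; χ-holds = χα ; image = r }))

mainTheorem8 : {AtSen Agents : Set} (Sig : ActionSignature Agents) →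
    let open Language AtSen Agents Sig in
      (α : Prog) → Simple α → (ψ : Sen) → (C : Agents → Set) → (χ : Prog → Sen) →
      (∀ β → α ⟶Ω*⟨ C ⟩ β → Valid (χ β ⇒ after β ψ)) →
      (∀ A β γ → C A → α ⟶Ω*⟨ C ⟩ β → β ⟶Ω⟨ A ⟩ γ →
         Valid (and (χ β) (Pre β) ⇒ box A (χ γ))) →
      Valid (χ α ⇒ after α (boxStar C ψ))
mainTheorem8 Sig α sα ψ C χ χ⇒[β]ψ χ∧Pre⇒□χ =
  ActionRule.action-rule Sig α C χ ψ χ⇒[β]ψ χ∧Pre⇒□χ sα
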